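{- Let $\phi(fx_1\dots x_q,fy_1\dots y_q)$ be a first-order formula in which the $q$-ary function symbol $f$ has an occurrence of the form $fx_1\dots x_q$ and an occurrence of the form $fy_1\dots y_q$, where $\{x_1,\dots,x_q\}\cap\{y_1,\dots,y_q\}=\emptyset$. Let $g$ be a new $q$-ary function variable and let $\phi(fx_1\dots x_q,gy_1\dots y_q)$ be obtained by replacing everywhere $fy_1\dots y_q$ by $gy_1\dots y_q$. Then $$\models\forall x_1\dots\forall x_q\forall y_1\dots\forall y_q\,\phi(fx_1\dots x_q,fy_1\dots y_q)\leftrightarrow\exists g\,\forall x_1\dots\forall x_q\forall y_1\dots\forall y_q\Big(\phi(fx_1\dots x_q,gy_1\dots y_q)\wedge\big((x_1=y_1)\wedge\dots\wedge(x_q=y_q)\to(fx_1\dots x_q=gy_1\dots y_q)\big)\Big).$$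
   Context: Here $\models$ denotes validity in second-order logic with standard semantics ($\exists g$ ranges over all $q$-ary functions on the domain); structures have nonempty domains. -}

module Defs where

open import Data.Nat using (ℕ; _≟_)
open import Data.Vec using (Vec; []; _∷_; map)
open import Data.List using (List; []; _∷_; foldr)
open import Data.Bool using (Bool; true; false; if_then_else_; _∧_)
open import Data.Product using (Σ; _×_)
open import Data.Sum using (_⊎_)
open import Data.Empty using (⊥)
open import Relation.Binary.PropositionalEquality using (_≡_)
open import Relation.Nullary.Decidable using (⌊_⌋)

-- A first-order signature (function and relation symbols with arities),
-- in addition to which the syntax below always has the distinguished
-- q-ary function symbol f and the q-ary function variable g.
record Signature : Set₁ where
  field
    FSym   : Set
    fArity : FSym → ℕ
    RSym   : Set
    rArity : RSym → ℕ

module Syntax (S : Signature) (q : ℕ) where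
  open Signature S

  data Term : Set where
    var : ℕ → Term
    fun : (s : FSym) → Vec Term (fArity s) → Term
    fT  : Vec Term q → Term
    gT  : Vec Term q → Term

  data Formula : Set where
    _≐_  : Term → Term → Formula
    rel  : (r : RSym) → Vec Term (rArity r) → Formula
    ⊥'   : Formula
    _⇒_  : Formula → Formula → Formula
    _∧'_ : Formula → Formula → Formula
    _∨'_ : Formula → Formula → Formula
    ∀'   : ℕ → Formula → Formula
    ∃'   : ℕ → Formula → Formula

  ⊤' : Formula
  ⊤' = ⊥' ⇒ ⊥'

  vars : ∀ {n} → Vec ℕ n → Vec Term n
  vars = map var

  ∀* : List ℕ → Formula → Formula
  ∀* zs φ = foldr ∀' φ zs

  eqConj : ∀ {n} → Vec ℕ n → Vec ℕ n → Formula
  eqConj [] [] = ⊤'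
  eqConj (x ∷ xs) (y ∷ ys) = (var x ≐ var y) ∧' eqConj xs ys

  isVars : ∀ {n} → Vec Term n → Vec ℕ n → Bool
  isVars [] [] = true
  isVars (var x ∷ ts) (y ∷ ys) = ⌊ x ≟ y ⌋ ∧ isVars ts ys
  isVars (_ ∷ ts) (_ ∷ ys) = false

  mutual
    replT : Vec ℕ q → Term → Term
    replT ys (var x) = var x
    replT ys (fun s ts) = fun s (replTs ys ts)
    replT ys (fT ts) = if isVars ts ys then gT (vars ys) else fT (replTs ys ts)
    replT ys (gT ts) = gT (replTs ys ts)

    replTs : ∀ {n} → Vec ℕ q → Vec Term n → Vec Term n
    replTs ys [] = []
    replTs ys (t ∷ ts) = replT ys t ∷ replTs ys ts

  replF : Vec ℕ q → Formula → Formula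
  replF ys (t ≐ u) = replT ys t ≐ replT ys u
  replF ys (rel r ts) = rel r (replTs ys ts)
  replF ys ⊥' = ⊥'
  replF ys (φ ⇒ ψ) = replF ys φ ⇒ replF ys ψ
  replF ys (φ ∧' ψ) = replF ys φ ∧' replF ys ψ
  replF ys (φ ∨' ψ) = replF ys φ ∨' replF ys ψ
  replF ys (∀' x φ) = ∀' x (replF ys φ)
  replF ys (∃' x φ) = ∃' x (replF ys φ)

  mutual
    gFreeT : Term → Bool
    gFreeT (var x) = true
    gFreeT (fun s ts) = gFreeTs ts
    gFreeT (fT ts) = gFreeTs ts
    gFreeT (gT ts) = false

    gFreeTs : ∀ {n} → Vec Term n → Bool
    gFreeTs [] = true
    gFreeTs (t ∷ ts) = gFreeT t ∧ gFreeTs ts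

  gFreeF : Formula → Bool
  gFreeF (t ≐ u) = gFreeT t ∧ gFreeT u
  gFreeF (rel r ts) = gFreeTs ts
  gFreeF ⊥' = true
  gFreeF (φ ⇒ ψ) = gFreeF φ ∧ gFreeF ψ
  gFreeF (φ ∧' ψ) = gFreeF φ ∧ gFreeF ψ
  gFreeF (φ ∨' ψ) = gFreeF φ ∧ gFreeF ψ
  gFreeF (∀' x φ) = gFreeF φ
  gFreeF (∃' x φ) = gFreeF φ

  mutual
    data OccT (t : Term) : Term → Set where
      here  : OccT t t
      inFun : ∀ {s ts} → OccTs t ts → OccT t (fun s ts)
      inF   : ∀ {ts} → OccTs t ts → OccT t (fT ts)
      inG   : ∀ {ts} → OccTs t ts → OccT t (gT ts)

    data OccTs (t : Term) : ∀ {n} → Vec Term n → Set where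
      hd : ∀ {n u} {us : Vec Term n} → OccT t u → OccTs t (u ∷ us)
      tl : ∀ {n u} {us : Vec Term n} → OccTs t us → OccTs t (u ∷ us)

  data OccF (t : Term) : Formula → Set where
    eqˡ  : ∀ {u v} → OccT t u → OccF t (u ≐ v)
    eqʳ  : ∀ {u v} → OccT t v → OccF t (u ≐ v)
    inRel : ∀ {r ts} → OccTs t ts → OccF t (rel r ts)
    ⇒ˡ : ∀ {φ ψ} → OccF t φ → OccF t (φ ⇒ ψ)
    ⇒ʳ : ∀ {φ ψ} → OccF t ψ → OccF t (φ ⇒ ψ)
    ∧ˡ : ∀ {φ ψ} → OccF t φ → OccF t (φ ∧' ψ)
    ∧ʳ : ∀ {φ ψ} → OccF t ψ → OccF t (φ ∧' ψ)
    ∨ˡ : ∀ {φ ψ} → OccF t φ → OccF t (φ ∨' ψ)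
    ∨ʳ : ∀ {φ ψ} → OccF t ψ → OccF t (φ ∨' ψ)
    in∀ : ∀ {x φ} → OccF t φ → OccF t (∀' x φ)
    in∃ : ∀ {x φ} → OccF t φ → OccF t (∃' x φ)

  record Structure : Set₁ where
    field
      D         : Set
      inhabited : D
      funI      : (s : FSym) → Vec D (fArity s) → D
      relI      : (r : RSym) → Vec D (rArity r) → Set

  module Semantics (M : Structure) where
    open Structure M

    Assign : Set
    Assign = ℕ → D

    _[_↦_] : Assign → ℕ → D → Assign
    (ρ [ x ↦ d ]) y = if ⌊ y ≟ x ⌋ then d else ρ y

    mutual
      evalT : (fI gI : Vec D q → D) → Assign → Term → D
      evalT fI gI ρ (var x) = ρ x
      evalT fI gI ρ (fun s ts) = funI s (evalTs fI gI ρ ts)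
      evalT fI gI ρ (fT ts) = fI (evalTs fI gI ρ ts)
      evalT fI gI ρ (gT ts) = gI (evalTs fI gI ρ ts)

      evalTs : ∀ {n} → (fI gI : Vec D q → D) → Assign → Vec Term n → Vec D n
      evalTs fI gI ρ [] = []
      evalTs fI gI ρ (t ∷ ts) = evalT fI gI ρ t ∷ evalTs fI gI ρ ts

    Sat : (fI gI : Vec D q → D) → Assign → Formula → Set
    Sat fI gI ρ (t ≐ u) = evalT fI gI ρ t ≡ evalT fI gI ρ u
    Sat fI gI ρ (rel r ts) = relI r (evalTs fI gI ρ ts)
    Sat fI gI ρ ⊥' = ⊥
    Sat fI gI ρ (φ ⇒ ψ) = Sat fI gI ρ φ → Sat fI gI ρ ψ
    Sat fI gI ρ (φ ∧' ψ) = Sat fI gI ρ φ × Sat fI gI ρ ψ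
    Sat fI gI ρ (φ ∨' ψ) = Sat fI gI ρ φ ⊎ Sat fI gI ρ ψ
    Sat fI gI ρ (∀' x φ) = (d : D) → Sat fI gI (ρ [ x ↦ d ]) φ
    Sat fI gI ρ (∃' x φ) = Σ D λ d → Sat fI gI (ρ [ x ↦ d ]) φ

-- Taking g := f proves the forward direction, because φ does not mention g, so
-- replacing f y⃗ by g y⃗ = f y⃗ changes nothing. Conversely, since x⃗ and y⃗ are
-- disjoint lists of distinct variables, any argument tuple v can be assigned to
-- both of them at once; the agreement clause then yields f v = g v. Hence g = f
-- pointwise, and the replaced formula says the same as φ.
module Submission where

open import Defs
open import Data.Nat using (ℕ; _≟_)
open import Data.Vec using (Vec; toList; []; _∷_; map)
open import Data.Vec.Properties using (∷-injective)
open import Data.List using ([]; _∷_; _++_)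
open import Data.List.Properties using (foldr-++)
open import Data.List.Membership.Propositional using (_∈_)
open import Data.List.Relation.Unary.Any using (here; there)
open import Data.List.Relation.Unary.All.Properties using (All¬⇒¬Any)
open import Data.List.Relation.Unary.AllPairs using (_∷_)
open import Data.List.Relation.Unary.Unique.Propositional using (Unique)
open import Data.List.Relation.Binary.Disjoint.Propositional using (Disjoint)
import Data.List.Relation.Binary.Disjoint.Propositional.Properties as Disjoint
open import Data.Bool using (true; false; _∧_)
open import Data.Product using (Σ; _×_; _,_; proj₂)
open import Data.Product.Function.NonDependent.Propositional using (_×-⇔_)
open import Data.Product.Function.Dependent.Propositional using (Σ-⇔)
open import Data.Sum.Function.Propositional using (_⊎-⇔_)
open import Function using (_∘_; id)
open import Function.Bundles using (_⇔_; mk⇔; Equivalence)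
open import Function.Construct.Identity using (⇔-id; ↠-id)
open import Function.Related.TypeIsomorphisms using (→-cong-⇔)
open import Relation.Nullary using (¬_; yes; no; contradiction)
open import Relation.Binary.PropositionalEquality
  using (_≡_; _≗_; refl; sym; trans; cong; cong₂; subst; module ≡-Reasoning)

open Equivalence using (to; from)

∧-≡-true : ∀ {a b} → a ∧ b ≡ true → a ≡ true × b ≡ true
∧-≡-true {true} b≡true = refl , b≡true

≡⇒⇔ : ∀ {A B : Set} → A ≡ B → A ⇔ B
≡⇒⇔ refl = ⇔-id _

Π-⇔ : ∀ {A : Set} {P Q : A → Set} → (∀ a → P a ⇔ Q a) → ((a : A) → P a) ⇔ ((a : A) → Q a)
Π-⇔ P⇔Q = mk⇔ (λ p a → to (P⇔Q a) (p a)) (λ q a → from (P⇔Q a) (q a))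

module SyntaxProperties (S : Signature) (q : ℕ) where
  open Syntax S q

  isVars-sound : ∀ {n} (ts : Vec Term n) (zs : Vec ℕ n) → isVars ts zs ≡ true → ts ≡ vars zs
  isVars-sound []           []       _ = refl
  isVars-sound (var x ∷ ts) (z ∷ zs) p with x ≟ z
  isVars-sound (var x ∷ ts) (x ∷ zs) p | yes refl = cong (var x ∷_) (isVars-sound ts zs p)
  isVars-sound (var x ∷ ts) (z ∷ zs) () | no _
  isVars-sound (fun _ _ ∷ _) (_ ∷ _) ()
  isVars-sound (fT _ ∷ _)    (_ ∷ _) ()
  isVars-sound (gT _ ∷ _)    (_ ∷ _) ()

  agreement : Vec ℕ q → Vec ℕ q → Formula
  agreement xs ys = eqConj xs ys ⇒ (fT (vars xs) ≐ gT (vars ys))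

  module SemanticsProperties (M : Structure) where
    open Structure M
    open Semantics M

    evalTs-vars : ∀ {n} f g ρ (zs : Vec ℕ n) → evalTs f g ρ (vars zs) ≡ map ρ zs
    evalTs-vars f g ρ []       = refl
    evalTs-vars f g ρ (z ∷ zs) = cong (ρ z ∷_) (evalTs-vars f g ρ zs)

    module _ (ys : Vec ℕ q) {f g g₀ : Vec D q → D} (f≗g : f ≗ g) where

      mutual
        evalT-replT : ∀ ρ t → gFreeT t ≡ true → evalT f g ρ (replT ys t) ≡ evalT f g₀ ρ t
        evalT-replT ρ (var x)    _    = refl
        evalT-replT ρ (fun s ts) free = cong (funI s) (evalTs-replTs ρ ts free)
        evalT-replT ρ (gT ts)    ()
        evalT-replT ρ (fT ts)    free with isVars ts ys in ts≡ys
        ... | false = cong f (evalTs-replTs ρ ts free)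
        ... | true rewrite isVars-sound ts ys ts≡ys = begin
          g (evalTs f g ρ (vars ys))  ≡⟨ cong g (evalTs-vars f g ρ ys) ⟩
          g (map ρ ys)                ≡⟨ sym (f≗g (map ρ ys)) ⟩
          f (map ρ ys)                ≡⟨ cong f (sym (evalTs-vars f g₀ ρ ys)) ⟩
          f (evalTs f g₀ ρ (vars ys)) ∎
          where open ≡-Reasoning

        evalTs-replTs : ∀ {n} ρ (ts : Vec Term n) → gFreeTs ts ≡ true →
          evalTs f g ρ (replTs ys ts) ≡ evalTs f g₀ ρ ts
        evalTs-replTs ρ []       _    = refl
        evalTs-replTs ρ (t ∷ ts) free =
          let t-free , ts-free = ∧-≡-true free in
          cong₂ _∷_ (evalT-replT ρ t t-free) (evalTs-replTs ρ ts ts-free)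

      Sat-replF : ∀ ρ φ → gFreeF φ ≡ true → Sat f g ρ (replF ys φ) ⇔ Sat f g₀ ρ φ
      Sat-replF ρ (t ≐ u) free =
        let t-free , u-free = ∧-≡-true free in
        ≡⇒⇔ (cong₂ _≡_ (evalT-replT ρ t t-free) (evalT-replT ρ u u-free))
      Sat-replF ρ (rel r ts) free = ≡⇒⇔ (cong (relI r) (evalTs-replTs ρ ts free))
      Sat-replF ρ ⊥'         _    = ⇔-id _
      Sat-replF ρ (φ ⇒ ψ)    free =
        let φ-free , ψ-free = ∧-≡-true free in
        →-cong-⇔ (Sat-replF ρ φ φ-free) (Sat-replF ρ ψ ψ-free)
      Sat-replF ρ (φ ∧' ψ)   free =
        let φ-free , ψ-free = ∧-≡-true free in
        Sat-replF ρ φ φ-free ×-⇔ Sat-replF ρ ψ ψ-free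
      Sat-replF ρ (φ ∨' ψ)   free =
        let φ-free , ψ-free = ∧-≡-true free in
        Sat-replF ρ φ φ-free ⊎-⇔ Sat-replF ρ ψ ψ-free
      Sat-replF ρ (∀' x φ)   free = Π-⇔ (λ d → Sat-replF (ρ [ x ↦ d ]) φ free)
      Sat-replF ρ (∃' x φ)   free = Σ-⇔ (↠-id D) (λ {d} → Sat-replF (ρ [ x ↦ d ]) φ free)

    Sat-eqConj : ∀ {n f g ρ} (xs ys : Vec ℕ n) → Sat f g ρ (eqConj xs ys) ⇔ (map ρ xs ≡ map ρ ys)
    Sat-eqConj []       []       = mk⇔ (λ _ → refl) (λ _ → id)
    Sat-eqConj (x ∷ xs) (y ∷ ys) = mk⇔
      (λ (x≡y , xs≡ys) → cong₂ _∷_ x≡y (to (Sat-eqConj xs ys) xs≡ys))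
      (λ eq → let x≡y , xs≡ys = ∷-injective eq in x≡y , from (Sat-eqConj xs ys) xs≡ys)

    Sat-agreement : ∀ {f g ρ} (xs ys : Vec ℕ q) →
      Sat f g ρ (agreement xs ys) ⇔ (map ρ xs ≡ map ρ ys → f (map ρ xs) ≡ g (map ρ ys))
    Sat-agreement {f} {g} {ρ} xs ys = →-cong-⇔ (Sat-eqConj xs ys)
      (≡⇒⇔ (cong₂ _≡_ (cong f (evalTs-vars f g ρ xs)) (cong g (evalTs-vars f g ρ ys))))

    [↦]-same : ∀ ρ z d → (ρ [ z ↦ d ]) z ≡ d
    [↦]-same ρ z d with z ≟ z
    ... | yes _   = refl
    ... | no z≢z = contradiction refl z≢z

    [↦]-other : ∀ ρ {z y} d → ¬ y ≡ z → (ρ [ z ↦ d ]) y ≡ ρ y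
    [↦]-other ρ {z} {y} d y≢z with y ≟ z
    ... | yes y≡z = contradiction y≡z y≢z
    ... | no _    = refl

    -- Updates are applied from the left, in the order in which ∀* binds the variables.
    _[_↦*_] : ∀ {n} → Assign → Vec ℕ n → Vec D n → Assign
    ρ [ []     ↦* []     ] = ρ
    ρ [ z ∷ zs ↦* d ∷ ds ] = (ρ [ z ↦ d ]) [ zs ↦* ds ]

    [↦*]-fresh : ∀ {n} ρ (zs : Vec ℕ n) ds {y} → ¬ y ∈ toList zs → (ρ [ zs ↦* ds ]) y ≡ ρ y
    [↦*]-fresh ρ []       []       _   = refl
    [↦*]-fresh ρ (z ∷ zs) (d ∷ ds) y∉ =
      trans ([↦*]-fresh (ρ [ z ↦ d ]) zs ds (y∉ ∘ there)) ([↦]-other ρ d (y∉ ∘ here))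

    map-[↦*]-fresh : ∀ {m n} ρ (zs : Vec ℕ m) ds (ws : Vec ℕ n) →
      Disjoint (toList zs) (toList ws) → map (ρ [ zs ↦* ds ]) ws ≡ map ρ ws
    map-[↦*]-fresh ρ zs ds []       _        = refl
    map-[↦*]-fresh ρ zs ds (w ∷ ws) disjoint = cong₂ _∷_
      ([↦*]-fresh ρ zs ds (λ w∈zs → disjoint (w∈zs , here refl)))
      (map-[↦*]-fresh ρ zs ds ws (λ (v∈zs , v∈ws) → disjoint (v∈zs , there v∈ws)))

    map-[↦*] : ∀ {n} ρ (zs : Vec ℕ n) ds → Unique (toList zs) → map (ρ [ zs ↦* ds ]) zs ≡ ds
    map-[↦*] ρ []       []       _                = refl
    map-[↦*] ρ (z ∷ zs) (d ∷ ds) (z∉zs ∷ unique) = cong₂ _∷_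
      (trans ([↦*]-fresh (ρ [ z ↦ d ]) zs ds (All¬⇒¬Any z∉zs)) ([↦]-same ρ z d))
      (map-[↦*] (ρ [ z ↦ d ]) zs ds unique)

    ∀*-mono : ∀ {f g f′ g′ φ ψ} → (∀ ρ → Sat f g ρ φ → Sat f′ g′ ρ ψ) →
      ∀ zs ρ → Sat f g ρ (∀* zs φ) → Sat f′ g′ ρ (∀* zs ψ)
    ∀*-mono φ⇒ψ []       ρ h   = φ⇒ψ ρ h
    ∀*-mono φ⇒ψ (z ∷ zs) ρ h d = ∀*-mono φ⇒ψ zs (ρ [ z ↦ d ]) (h d)

    ∀*-++ : ∀ {f g} zs ws ψ ρ → Sat f g ρ (∀* (zs ++ ws) ψ) → Sat f g ρ (∀* zs (∀* ws ψ))
    ∀*-++ {f} {g} zs ws ψ ρ = subst (Sat f g ρ) (foldr-++ ∀' ψ zs ws)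

    ∀*-elim : ∀ {n f g ψ} ρ (zs : Vec ℕ n) ds → Sat f g ρ (∀* (toList zs) ψ) → Sat f g (ρ [ zs ↦* ds ]) ψ
    ∀*-elim ρ []       []       h = h
    ∀*-elim ρ (z ∷ zs) (d ∷ ds) h = ∀*-elim (ρ [ z ↦ d ]) zs ds (h d)

    agreement⇒≗ : ∀ {f g ψ} (xs ys : Vec ℕ q) ρ →
      Unique (toList xs) → Unique (toList ys) → Disjoint (toList xs) (toList ys) →
      Sat f g ρ (∀* (toList xs ++ toList ys) (ψ ∧' agreement xs ys)) → f ≗ g
    agreement⇒≗ {f} {g} {ψ} xs ys ρ xs-unique ys-unique disjoint h v = begin
      f v            ≡⟨ cong f (sym xs↦v) ⟩
      f (map σ xs)   ≡⟨ to (Sat-agreement xs ys) (proj₂ body) (trans xs↦v (sym ys↦v)) ⟩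
      g (map σ ys)   ≡⟨ cong g ys↦v ⟩
      g v            ∎
      where
      open ≡-Reasoning
      σ : Assign
      σ = (ρ [ xs ↦* v ]) [ ys ↦* v ]
      body : Sat f g σ (ψ ∧' agreement xs ys)
      body = ∀*-elim _ ys v (∀*-elim ρ xs v (∀*-++ (toList xs) (toList ys) _ ρ h))
      xs↦v : map σ xs ≡ v
      xs↦v = trans (map-[↦*]-fresh _ ys v xs (Disjoint.sym disjoint)) (map-[↦*] ρ xs v xs-unique)
      ys↦v : map σ ys ≡ v
      ys↦v = map-[↦*] _ ys v ys-unique

-- The occurrence hypotheses only make the replacement non-vacuous; the
-- equivalence holds for every g-free φ.
lemma18 : (S : Signature) (q : ℕ) → let open Syntax S q in
    (φ : Formula) (xs ys : Vec ℕ q) →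
    gFreeF φ ≡ true →
    OccF (fT (vars xs)) φ →
    OccF (fT (vars ys)) φ →
    Unique (toList xs) →
    Unique (toList ys) →
    Disjoint (toList xs) (toList ys) →
    (M : Structure) → let open Structure M in let open Semantics M in
    (fI g₀ : Vec D q → D) (ρ : Assign) →
    Sat fI g₀ ρ (∀* (toList xs ++ toList ys) φ)
      ⇔ Σ (Vec D q → D) (λ g → Sat fI g ρ
            (∀* (toList xs ++ toList ys)
              (replF ys φ ∧' (eqConj xs ys ⇒ (fT (vars xs) ≐ gT (vars ys))))))
lemma18 S q φ xs ys g-free _ _ xs-unique ys-unique disjoint M fI g₀ ρ = mk⇔
  (λ h → fI , ∀*-mono
    (λ σ φσ → from (Sat-replF ys {g₀ = g₀} (λ _ → refl) σ φ g-free) φσ , from (Sat-agreement xs ys) (cong fI))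
    zs ρ h)
  (λ (g , h) → ∀*-mono
    (λ σ (φσ , _) → to (Sat-replF ys (agreement⇒≗ xs ys ρ xs-unique ys-unique disjoint h) σ φ g-free) φσ)
    zs ρ h)
  where
  open SyntaxProperties S q
  open SemanticsProperties M
  zs = toList xs ++ toList ys
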